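{- Let $\lambda=(\lambda_1,\lambda_2)$ be a partition with $\lambda_1\ge\lambda_2>0$ and $A=\mathcal{L}(\lambda)$. (1) If $\lambda_1=\lambda_2$, then $\mathbb{SG}(A)=0$ if $\lambda_1$ is even and $\mathbb{SG}(A)=2$ if $\lambda_1$ is odd. (2) If $\lambda_1>\lambda_2>0$, then $\mathbb{SG}(A)=0$ if $\lambda_2$ is odd and $\mathbb{SG}(A)=1$ if $\lambda_2$ is even.
   Context: For a partition $\mu=(\mu_1,\dots,\mu_s)$ and nonnegative integers $i,j$, $\mu[i,j]$ is $(\mu_{i+1}-j,\mu_{i+2}-j,\dots)$ with nonpositive entries removed, if $i<s$ and $j<\mu_{i+1}$; otherwise $\mu[i,j]=()$. LCTR $\mathcal{L}(\lambda)$: impartial normal-play game on partitions; from a nonempty $\mu$ one moves to $\mu[1,0]$ (delete top row) or $\mu[0,1]$ (delete left column); $()$ is terminal. $\mathbb{SG}$ is the Sprague--Grundy value, $\mathbb{SG}(A)=\operatorname{mex}\{\mathbb{SG}(B):A\to B\}$. -}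

module Defs where

open import Data.Nat using (ℕ; zero; suc; _+_; _∸_)
open import Data.Nat.Properties using (_≟_)
open import Data.List using (List; []; _∷_; map; filter; length)
open import Data.Nat.ListAction using (sum)
open import Data.List.Membership.DecPropositional (_≟_) using (_∈?_)
open import Relation.Nullary using (does)
open import Relation.Nullary.Decidable using (¬?)
open import Data.Bool using (if_then_else_)

-- A partition μ = (μ₁, …, μₛ) is represented as the list of its parts
-- (nonincreasing, positive).

delRow : List ℕ → List ℕ
delRow []       = []
delRow (_ ∷ xs) = xs

delCol : List ℕ → List ℕ
delCol xs = filter (λ x → ¬? (x ≟ 0)) (map (λ x → x ∸ 1) xs)

moves : List ℕ → List (List ℕ)
moves []         = []
moves μ@(_ ∷ _) = delRow μ ∷ delCol μ ∷ []

-- mex of a finite list of naturals (the mex is at most the length).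
mexGo : ℕ → ℕ → List ℕ → ℕ
mexGo zero    k xs = k
mexGo (suc f) k xs = if does (k ∈? xs) then mexGo f (suc k) xs else k

mex : List ℕ → ℕ
mex xs = mexGo (length xs) 0 xs

-- Sprague–Grundy value, computed with fuel. Every move from a nonempty
-- partition (positive parts) strictly decreases the sum of parts, so
-- fuel  sum μ + 1  suffices.
sgFuel : ℕ → List ℕ → ℕ
sgFuel zero    μ = 0
sgFuel (suc f) μ = mex (map (sgFuel f) (moves μ))

SG : List ℕ → ℕ
SG μ = sgFuel (suc (sum μ)) μ

SG-L : List ℕ → ℕ
SG-L λ' = SG λ'

-- From (l + d, l) with l > 0, deleting the top row leaves the row (l) and deleting
-- the left column leaves (l - 1 + d, l - 1); a row (n) moves to () and (n - 1).
-- So the row values r(n) alternate 1, 2, 1, 2, … and the values of (l + d, l)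
-- satisfy  v(l) = mex {r(l), v(l - 1)}  with  v(0) = r(d).  For l ≥ 1 both are
-- 2-periodic in l, and v(1), v(2) only depend on whether d = 0.
module Submission where

open import Defs
open import Data.Nat using (ℕ; zero; suc; _+_; _∸_; _%_; _≤_; _<_; z≤n; s≤s)
open import Data.Nat.Properties using (≤-trans; <⇒≤; m≤m+n; n∸n≡0; m<n⇒0<n∸m; m+[n∸m]≡n)
open import Data.List using (List; []; _∷_)
open import Data.Product using (_×_; _,_)
open import Relation.Binary.PropositionalEquality using (_≡_; refl; trans; cong; cong₂; subst)

mex₂ : ℕ → ℕ → ℕ
mex₂ x y = mex (x ∷ y ∷ [])

module TwoPeriodicFromOne {A : Set} (f : ℕ → A) (period : ∀ n → f (3 + n) ≡ f (1 + n)) where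

  value-odd : ∀ n → n % 2 ≡ 1 → f n ≡ f 1
  value-odd 0 ()
  value-odd 1 _ = refl
  value-odd 2 ()
  value-odd (suc (suc (suc n))) odd = trans (period n) (value-odd (suc n) odd)

  value-even : ∀ n → 0 < n → n % 2 ≡ 0 → f n ≡ f 2
  value-even 1 _ ()
  value-even 2 _ _ = refl
  value-even 3 _ ()
  value-even (suc (suc (suc (suc n)))) _ even =
    trans (period (suc n)) (value-even (suc (suc n)) (s≤s z≤n) even)

row : ℕ → List ℕ
row zero    = []
row (suc n) = suc n ∷ []

rowSG : ℕ → ℕ
rowSG zero    = 0
rowSG (suc n) = mex₂ 0 (rowSG n)

-- twoRowSG d l is the value of (l + d, l).
twoRowSG : ℕ → ℕ → ℕ
twoRowSG d zero    = rowSG d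
twoRowSG d (suc l) = mex₂ (rowSG (suc l)) (twoRowSG d l)

rowSG-period : ∀ n → rowSG (3 + n) ≡ rowSG (1 + n)
rowSG-period zero    = refl
rowSG-period (suc n) = cong (mex₂ 0) (rowSG-period n)

mex₂-1-2-1 : ∀ v → mex₂ 1 (mex₂ 2 (mex₂ 1 v)) ≡ mex₂ 1 v
mex₂-1-2-1 zero    = refl
mex₂-1-2-1 (suc v) = refl

twoRowSG-period : ∀ d n → twoRowSG d (3 + n) ≡ twoRowSG d (1 + n)
twoRowSG-period d zero    = mex₂-1-2-1 (rowSG d)
twoRowSG-period d (suc n) = cong₂ mex₂ (rowSG-period (suc n)) (twoRowSG-period d n)

mex₂-1-mex₂-0 : ∀ v → mex₂ 1 (mex₂ 0 v) ≡ 0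
mex₂-1-mex₂-0 0             = refl
mex₂-1-mex₂-0 1             = refl
mex₂-1-mex₂-0 (suc (suc v)) = refl

twoRowSG-strict-one : ∀ d → twoRowSG (suc d) 1 ≡ 0
twoRowSG-strict-one d = mex₂-1-mex₂-0 (rowSG d)

twoRowSG-square-odd : ∀ l → l % 2 ≡ 1 → twoRowSG 0 l ≡ 2
twoRowSG-square-odd = TwoPeriodicFromOne.value-odd (twoRowSG 0) (twoRowSG-period 0)

twoRowSG-square-even : ∀ l → 0 < l → l % 2 ≡ 0 → twoRowSG 0 l ≡ 0
twoRowSG-square-even = TwoPeriodicFromOne.value-even (twoRowSG 0) (twoRowSG-period 0)

twoRowSG-strict-odd : ∀ {d} l → 0 < d → l % 2 ≡ 1 → twoRowSG d l ≡ 0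
twoRowSG-strict-odd {suc d} l _ odd =
  trans (TwoPeriodicFromOne.value-odd (twoRowSG (suc d)) (twoRowSG-period (suc d)) l odd)
        (twoRowSG-strict-one d)

twoRowSG-strict-even : ∀ {d} l → 0 < d → 0 < l → l % 2 ≡ 0 → twoRowSG d l ≡ 1
twoRowSG-strict-even {suc d} l _ 0<l even =
  trans (TwoPeriodicFromOne.value-even (twoRowSG (suc d)) (twoRowSG-period (suc d)) l 0<l even)
        (cong (mex₂ 2) (twoRowSG-strict-one d))

sgFuel-[] : ∀ f → sgFuel f [] ≡ 0
sgFuel-[] zero    = refl
sgFuel-[] (suc f) = refl

delCol-row : ∀ n → delCol (row (suc n)) ≡ row n
delCol-row zero    = refl
delCol-row (suc n) = refl

delCol-over-1 : ∀ d → delCol (suc d ∷ 1 ∷ []) ≡ row d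
delCol-over-1 zero    = refl
delCol-over-1 (suc d) = refl

sgFuel-row : ∀ {n f} → n ≤ f → sgFuel f (row n) ≡ rowSG n
sgFuel-row {zero}  {f}     _         = sgFuel-[] f
sgFuel-row {suc n} {suc f} (s≤s n≤f) =
  cong₂ mex₂ (sgFuel-[] f) (trans (cong (sgFuel f) (delCol-row n)) (sgFuel-row n≤f))

sgFuel-twoRows : ∀ {d l f} → l + d < f →
                 sgFuel (suc f) (suc l + d ∷ suc l ∷ []) ≡ twoRowSG d (suc l)
sgFuel-twoRows {d} {zero}  {f}     d<f =
  cong₂ mex₂ (sgFuel-row (≤-trans (s≤s z≤n) d<f))
             (trans (cong (sgFuel f) (delCol-over-1 d)) (sgFuel-row (<⇒≤ d<f)))
sgFuel-twoRows {d} {suc l} {suc f} (s≤s l+d<f) =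
  cong₂ mex₂ (sgFuel-row (s≤s (≤-trans (s≤s (m≤m+n l d)) l+d<f))) (sgFuel-twoRows l+d<f)

SG-twoRows : ∀ {l₁ l₂} → 0 < l₂ → l₂ ≤ l₁ → SG-L (l₁ ∷ l₂ ∷ []) ≡ twoRowSG (l₁ ∸ l₂) l₂
SG-twoRows {l₁} {suc l} _ l₂≤l₁ =
  subst (λ a → SG-L (a ∷ suc l ∷ []) ≡ twoRowSG (l₁ ∸ suc l) (suc l))
        (m+[n∸m]≡n l₂≤l₁)
        (sgFuel-twoRows {l₁ ∸ suc l} {l} (s≤s (m≤m+n (l + (l₁ ∸ suc l)) (suc l + 0))))

lemma5p2 : (l₁ l₂ : ℕ) → l₂ ≤ l₁ → 0 < l₂ →
    ((l₁ ≡ l₂ → (l₁ % 2 ≡ 0 → SG-L (l₁ ∷ l₂ ∷ []) ≡ 0)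
    × (l₁ % 2 ≡ 1 → SG-L (l₁ ∷ l₂ ∷ []) ≡ 2))
    × (l₂ < l₁ → (l₂ % 2 ≡ 1 → SG-L (l₁ ∷ l₂ ∷ []) ≡ 0)
    × (l₂ % 2 ≡ 0 → SG-L (l₁ ∷ l₂ ∷ []) ≡ 1)))
lemma5p2 l₁ l₂ l₂≤l₁ 0<l₂ rewrite SG-twoRows 0<l₂ l₂≤l₁ = square , strict
  where
  square : l₁ ≡ l₂ → (l₁ % 2 ≡ 0 → twoRowSG (l₁ ∸ l₂) l₂ ≡ 0)
                   × (l₁ % 2 ≡ 1 → twoRowSG (l₁ ∸ l₂) l₂ ≡ 2)
  square refl rewrite n∸n≡0 l₁ = twoRowSG-square-even l₁ 0<l₂ , twoRowSG-square-odd l₁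

  strict : l₂ < l₁ → (l₂ % 2 ≡ 1 → twoRowSG (l₁ ∸ l₂) l₂ ≡ 0)
                   × (l₂ % 2 ≡ 0 → twoRowSG (l₁ ∸ l₂) l₂ ≡ 1)
  strict l₂<l₁ = twoRowSG-strict-odd l₂ (m<n⇒0<n∸m l₂<l₁)
               , twoRowSG-strict-even l₂ (m<n⇒0<n∸m l₂<l₁) 0<l₂
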